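{- Let $G$ be a connected multigraph and let $(L,H)$ be a cover of $G$ with $|L(v)|\ge\deg_G(v)$ for all $v\in V(G)$. Suppose there are a vertex $v_1\in V(G)$ and a color $x_1\in L(v_1)$ such that $G-v_1$ is connected and, for some $v_2\in V(G)\setminus\{v_1\}$, $x_1$ has fewer than $e_G(v_1,v_2)$ neighbors (in $H$) in $L(v_2)$. Then $G$ is $(L,H)$-colorable.
   Context: For a multigraph $G$ (no loops) and distinct $u,v\in V(G)$, $e_G(u,v)$ is the number of edges joining $u$ and $v$, and $\deg_G(v)=\sum_{u\neq v}e_G(v,u)$. A cover of $G$ is a pair $(L,H)$ where $L$ assigns pairwise disjoint sets $L(v)$ to the vertices and $H$ is a simple graph on $\bigcup_v L(v)$ such that each $H[L(v)]$ is complete and for distinct $u,v$ the edges of $H$ between $L(u)$ and $L(v)$ form the union of $e_G(u,v)$ (possibly empty) matchings. $G$ is $(L,H)$-colorable if $H$ has an independent set of size $|V(G)|$. -}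

module Defs where

open import Data.Nat using (ℕ; zero; suc; _<_; _≤_)
open import Data.Fin using (Fin)
open import Data.Bool using (Bool; true; false; T; if_then_else_)
open import Data.List using (List; map; allFin)
open import Data.Nat.ListAction using (sum)
open import Data.Product using (Σ; ∃; _×_; _,_)
open import Data.Unit using (⊤)
open import Relation.Nullary using (¬_)
open import Relation.Binary.PropositionalEquality using (_≡_; _≢_)
open import Function.Definitions using (Injective)

record Multigraph : Set where
  field
    n     : ℕ
    e     : Fin n → Fin n → ℕ
    e-sym : ∀ u v → e u v ≡ e v u
    loopless : ∀ v → e v v ≡ 0

open Multigraph public

-- deg_G(v) = Σ_{u ≠ v} e_G(v,u)  (the term u = v is 0 by looplessness)
deg : (G : Multigraph) → Fin (n G) → ℕ
deg G v = sum (map (e G v) (allFin (n G)))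

data Reach (G : Multigraph) (P : Fin (n G) → Set) : Fin (n G) → Fin (n G) → Set where
  here : ∀ {u} → P u → Reach G P u u
  step : ∀ {u v w} → P u → 0 < e G u v → Reach G P v w → Reach G P u w

Connected : Multigraph → Set
Connected G = Σ (Fin (n G)) (λ _ → ⊤) × (∀ u w → Reach G (λ _ → ⊤) u w)

ConnectedMinus : (G : Multigraph) → Fin (n G) → Set
ConnectedMinus G v = ∀ u w → u ≢ v → w ≢ v → Reach G (λ x → x ≢ v) u w

-- L(v) is represented by Fin (size v); the colours are
-- pairs (v , c) so the sets L(v) are automatically pairwise disjoint.
record Cover (G : Multigraph) : Set where
  field
    size : Fin (n G) → ℕ
    H    : Σ (Fin (n G)) (λ v → Fin (size v)) → Σ (Fin (n G)) (λ v → Fin (size v)) → Bool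
    H-sym   : ∀ a b → H a b ≡ H b a
    H-irrefl : ∀ a → H a a ≡ false
    H-complete : ∀ v (x y : Fin (size v)) → x ≢ y → H (v , x) (v , y) ≡ true
    -- for distinct u,v the H-edges between L(u) and L(v) form the union of
    -- e_G(u,v) matchings: each such edge gets a label in Fin (e_G(u,v)),
    -- and each label class is a matching.
    label : ∀ u v → u ≢ v → (x : Fin (size u)) (y : Fin (size v)) →
            T (H (u , x) (v , y)) → Fin (e G u v)
    label-matchingˡ : ∀ u v (p : u ≢ v) x y y' (h : T (H (u , x) (v , y))) (h' : T (H (u , x) (v , y'))) →
            label u v p x y h ≡ label u v p x y' h' → y ≡ y'
    label-matchingʳ : ∀ u v (p : u ≢ v) x x' y (h : T (H (u , x) (v , y))) (h' : T (H (u , x') (v , y))) →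
            label u v p x y h ≡ label u v p x' y h' → x ≡ x'

open Cover public

Colour : (G : Multigraph) → Cover G → Set
Colour G C = Σ (Fin (n G)) (λ v → Fin (size C v))

nbrsIn : (G : Multigraph) (C : Cover G) → Colour G C → Fin (n G) → ℕ
nbrsIn G C a v = sum (map (λ y → if H C a (v , y) then 1 else 0) (allFin (size C v)))

-- G is (L,H)-colourable: H has an independent set of size |V(G)|,
-- i.e. an injective map Fin |V(G)| → colours whose image is independent.
Colourable : (G : Multigraph) → Cover G → Set
Colourable G C = Σ (Fin (n G) → Colour G C) λ f →
  Injective _≡_ _≡_ f × (∀ i j → H C (f i) (f j) ≡ false)

-- Colour v₁ by x₁ and grow a vertex set from v₂ inside G − v₁, attaching one new neighbour at a
-- time, until it is all of G − v₁.  Colour greedily in the reverse order of attachment: every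
-- vertex u ≠ v₂ then still has an uncoloured neighbour w when its turn comes.  A coloured
-- neighbour w′ excludes at most e(u,w′) colours of L(u), since the edges between L(w′) and L(u)
-- form e(u,w′) matchings, and w excludes none; so fewer than deg(u) ≤ |L(u)| colours are
-- excluded.  For v₂, coloured last, the slack comes instead from x₁, which has fewer than
-- e(v₁,v₂) neighbours in L(v₂).

module Submission where

open import Defs
open import Data.Nat using (ℕ; zero; suc; _+_; _∸_; _<_; _≤_; z≤n; s≤s)
open import Data.Nat.Properties
  using ( ≤-refl; ≤-reflexive; ≤-trans; ≤-<-trans; <-≤-trans; ≤-pred; m≤m+n; m∸n≤m; ∸-monoʳ-<
        ; +-assoc; +-mono-≤; +-monoˡ-≤; +-mono-<-≤; +-mono-≤-<
        ; +-0-commutativeMonoid; module ≤-Reasoning)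
open import Data.Fin using (Fin; zero; suc; punchOut)
open import Data.Fin.Properties using (punchOut-injective; suc-injective; any?; _≟_)
open import Data.Fin.Subset using (Subset; _∈_; _∉_; ⁅_⁆; _∪_; ∣_∣)
open import Data.Fin.Subset.Properties
  using (_∈?_; x∈⁅x⁆; x∈⁅y⁆⇒x≡y; x∈p∪q⁺; x∈p∪q⁻; q⊆p∪q; p⊂q⇒∣p∣<∣q∣; ∣p∣≤n)
open import Data.Bool using (Bool; true; false; T; if_then_else_; _∨_)
open import Data.Bool.Properties using (∨-conicalˡ; ∨-conicalʳ)
open import Data.List using (tabulate; map; allFin)
open import Data.List.Properties using (map-tabulate)
import Data.Nat.ListAction as List
open import Data.Maybe using (Maybe; just; nothing)
open import Data.Product using (Σ; ∃; ∃₂; _×_; _,_; proj₁; proj₂)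
open import Data.Sum using (inj₁; inj₂)
open import Data.Unit using (tt)
open import Function using (_∘_; _⇔_; mk⇔; Equivalence)
open import Relation.Nullary using (yes; no; contradiction)
open import Relation.Nullary.Decidable using (¬?; _×-dec_)
open import Relation.Unary using (Decidable)
open import Relation.Binary.PropositionalEquality
open import Algebra.Properties.CommutativeMonoid.Sum +-0-commutativeMonoid
  using (sum-syntax; ∑-distrib-+; sum-replicate-zero)

sum-tabulate : ∀ {m} (f : Fin m → ℕ) → List.sum (tabulate f) ≡ ∑[ i < m ] f i
sum-tabulate {zero}  f = refl
sum-tabulate {suc m} f = cong (f zero +_) (sum-tabulate (f ∘ suc))

sum-map-allFin : ∀ {m} (f : Fin m → ℕ) → List.sum (map f (allFin m)) ≡ ∑[ i < m ] f i
sum-map-allFin f = trans (cong List.sum (map-tabulate (λ i → i) f)) (sum-tabulate f)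

∑-mono-≤ : ∀ {m} {f g : Fin m → ℕ} → (∀ i → f i ≤ g i) → ∑[ i < m ] f i ≤ ∑[ i < m ] g i
∑-mono-≤ {zero}  f≤g = z≤n
∑-mono-≤ {suc m} f≤g = +-mono-≤ (f≤g zero) (∑-mono-≤ (f≤g ∘ suc))

∑-mono-< : ∀ {m} {f g : Fin m → ℕ} → (∀ i → f i ≤ g i) → ∀ j → f j < g j →
           ∑[ i < m ] f i < ∑[ i < m ] g i
∑-mono-< {suc m} f≤g zero    fj<gj = +-mono-<-≤ fj<gj (∑-mono-≤ (f≤g ∘ suc))
∑-mono-< {suc m} f≤g (suc j) fj<gj = +-mono-≤-< (f≤g zero) (∑-mono-< (f≤g ∘ suc) j fj<gj)

count : ∀ {m} → (Fin m → Bool) → ℕ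
count {m} p = ∑[ i < m ] (if p i then 1 else 0)

count-false : ∀ m → count {m} (λ _ → false) ≡ 0
count-false m = sum-replicate-zero m

count-∨ : ∀ {m} (p q : Fin m → Bool) → count (λ i → p i ∨ q i) ≤ count p + count q
count-∨ p q = ≤-trans (∑-mono-≤ (λ i → ind-∨ (p i) (q i)))
                      (≤-reflexive (∑-distrib-+ (λ i → if p i then 1 else 0) (λ i → if q i then 1 else 0)))
  where
  ind-∨ : ∀ a b → (if a ∨ b then 1 else 0) ≤ (if a then 1 else 0) + (if b then 1 else 0)
  ind-∨ false b = ≤-refl
  ind-∨ true  b = s≤s z≤n

count<⇒false : ∀ {m} (p : Fin m → Bool) → count p < m → ∃ λ i → p i ≡ false
count<⇒false {suc m} p lt with p zero in p₀
... | false = zero , p₀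
... | true  = let i , pᵢ = count<⇒false (p ∘ suc) (≤-pred lt) in suc i , pᵢ

∑count<⇒avoid : ∀ {k m} (q : Fin k → Fin m → Bool) → ∑[ w < k ] count (q w) < m →
                ∃ λ y → ∀ w → q w y ≡ false
∑count<⇒avoid {k} {m} q lt =
  let y , _ , qy = go q (λ _ → false)
                      (subst (λ c → c + ∑[ w < k ] count (q w) < m) (sym (count-false m)) lt)
  in  y , qy
  where
  go : ∀ {k} (q : Fin k → Fin m → Bool) (p : Fin m → Bool) → count p + ∑[ w < k ] count (q w) < m →
       ∃ λ y → p y ≡ false × (∀ w → q w y ≡ false)
  go {zero}  q p lt = let y , py = count<⇒false p (≤-<-trans (m≤m+n _ 0) lt) in y , py , λ ()
  go {suc k} q p lt with go (q ∘ suc) (λ y → p y ∨ q zero y) (begin-strict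
      count (λ y → p y ∨ q zero y) + ∑[ w < k ] count (q (suc w))
        ≤⟨ +-monoˡ-≤ (∑[ w < k ] count (q (suc w))) (count-∨ p (q zero)) ⟩
      count p + count (q zero) + ∑[ w < k ] count (q (suc w))
        ≡⟨ +-assoc (count p) _ _ ⟩
      count p + ∑[ w < suc k ] count (q w)
        <⟨ lt ⟩
      m ∎)
    where open ≤-Reasoning
  ... | y , p∨q₀ , qₛ = y , ∨-conicalˡ _ _ p∨q₀ , λ { zero → ∨-conicalʳ _ _ p∨q₀ ; (suc w) → qₛ w }

count≤-injection : ∀ {m k} (p : Fin m → Bool) (f : ∀ y → T (p y) → Fin k) →
                   (∀ y y' h h' → f y h ≡ f y' h' → y ≡ y') → count p ≤ k
count≤-injection {zero}  p f inj = z≤n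
count≤-injection {suc m} p f inj with p zero in p₀
... | false = count≤-injection (p ∘ suc) (f ∘ suc) (λ y y' h h' → suc-injective ∘ inj _ _ h h')
count≤-injection {suc m} {zero} p f inj | true with f zero (subst T (sym p₀) tt)
... | ()
count≤-injection {suc m} {suc k} p f inj | true = s≤s (count≤-injection (p ∘ suc) f′ inj′)
  where
  h₀ : T (p zero)
  h₀ = subst T (sym p₀) tt
  f₀≢f : ∀ y h → f zero h₀ ≢ f (suc y) h
  f₀≢f y h eq with inj zero (suc y) h₀ h eq
  ... | ()
  f′ : ∀ y → T (p (suc y)) → Fin k
  f′ y h = punchOut (f₀≢f y h)
  inj′ : ∀ y y' h h' → f′ y h ≡ f′ y' h' → y ≡ y'
  inj′ y y' h h' eq = suc-injective (inj _ _ h h' (punchOut-injective (f₀≢f y h) (f₀≢f y' h') eq))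

module _ (G : Multigraph) where

  data Grown (r : Fin (n G)) : Subset (n G) → Set where
    root   : Grown r ⁅ r ⁆
    attach : ∀ {S} u w → Grown r S → u ∉ S → w ∈ S → 0 < e G u w → Grown r (⁅ u ⁆ ∪ S)

  reach-start : ∀ {P a b} → Reach G P a b → P a
  reach-start (here pa)     = pa
  reach-start (step pa _ _) = pa

  reach-leaves : ∀ {P a b} (S : Subset (n G)) → Reach G P a b → a ∈ S → b ∉ S →
                 ∃₂ λ x y → x ∈ S × y ∉ S × P y × 0 < e G x y
  reach-leaves S (here _) a∈S b∉S = contradiction a∈S b∉S
  reach-leaves S (step {u} {v} _ e>0 walk) u∈S b∉S with v ∈? S
  ... | yes v∈S = reach-leaves S walk v∈S b∉S
  ... | no  v∉S = u , v , u∈S , v∉S , reach-start walk , e>0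

  grown-root : ∀ {r S} → Grown r S → r ∈ S
  grown-root {r} root                  = x∈⁅x⁆ r
  grown-root (attach _ _ grown _ _ _) = x∈p∪q⁺ (inj₂ (grown-root grown))

  spanning-growth : ∀ {P : Fin (n G) → Set} → Decidable P → ∀ r → P r →
                    (∀ v → P v → Reach G P r v) → ∃ λ S → Grown r S × (∀ v → v ∈ S ⇔ P v)
  spanning-growth {P} P? r Pr connected = grow (n G) root ⁅r⁆⊆P (m∸n≤m (n G) ∣ ⁅ r ⁆ ∣)
    where
    ⁅r⁆⊆P : ∀ v → v ∈ ⁅ r ⁆ → P v
    ⁅r⁆⊆P v v∈⁅r⁆ = subst P (sym (x∈⁅y⁆⇒x≡y r v∈⁅r⁆)) Pr

    grow : ∀ k {S} → Grown r S → (∀ v → v ∈ S → P v) → n G ∸ ∣ S ∣ ≤ k →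
           ∃ λ S → Grown r S × (∀ v → v ∈ S ⇔ P v)
    grow k {S} grown S⊆P bound with any? (λ v → P? v ×-dec ¬? (v ∈? S))
    ... | no ∄v = S , grown , λ v → mk⇔ (S⊆P v) (P⊆S v)
      where
      P⊆S : ∀ v → P v → v ∈ S
      P⊆S v Pv with v ∈? S
      ... | yes v∈S = v∈S
      ... | no  v∉S = contradiction (v , Pv , v∉S) ∄v
    ... | yes (v , Pv , v∉S) with reach-leaves S (connected v Pv) (grown-root grown) v∉S
    ... | x , y , x∈S , y∉S , Py , e>0 = grow-on k (<-≤-trans shrinks bound)
      where
      S⊂S′ : ∣ S ∣ < ∣ ⁅ y ⁆ ∪ S ∣
      S⊂S′ = p⊂q⇒∣p∣<∣q∣ (q⊆p∪q ⁅ y ⁆ S , y , x∈p∪q⁺ (inj₁ (x∈⁅x⁆ y)) , y∉S)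
      shrinks : n G ∸ ∣ ⁅ y ⁆ ∪ S ∣ < n G ∸ ∣ S ∣
      shrinks = ∸-monoʳ-< S⊂S′ (∣p∣≤n (⁅ y ⁆ ∪ S))
      S′⊆P : ∀ v → v ∈ ⁅ y ⁆ ∪ S → P v
      S′⊆P v v∈S′ with x∈p∪q⁻ ⁅ y ⁆ S v∈S′
      ... | inj₁ v∈⁅y⁆ = subst P (sym (x∈⁅y⁆⇒x≡y y v∈⁅y⁆)) Py
      ... | inj₂ v∈S   = S⊆P v v∈S
      grow-on : ∀ k → n G ∸ ∣ ⁅ y ⁆ ∪ S ∣ < k → ∃ λ S → Grown r S × (∀ v → v ∈ S ⇔ P v)
      grow-on (suc k) bound′ =
        grow k (attach y x grown y∉S x∈S (subst (0 <_) (e-sym G x y) e>0)) S′⊆P (≤-pred bound′)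

module PartialColourings {G : Multigraph} (C : Cover G) where

  PartialColouring : Set
  PartialColouring = (v : Fin (n G)) → Maybe (Fin (size C v))

  Proper : PartialColouring → Set
  Proper φ = ∀ a b {ca cb} → φ a ≡ just ca → φ b ≡ just cb → H C (a , ca) (b , cb) ≡ false

  Complete : PartialColouring → Set
  Complete φ = ∀ v → ∃ λ c → φ v ≡ just c

  Free : PartialColouring → (u : Fin (n G)) → Fin (size C u) → Set
  Free φ u y = ∀ w {c} → φ w ≡ just c → H C (w , c) (u , y) ≡ false

  complete⇒colourable : ∀ φ → Proper φ → Complete φ → Colourable G C
  complete⇒colourable φ proper complete =
    (λ v → v , proj₁ (complete v)) , cong proj₁ ,
    λ a b → proper a b (proj₂ (complete a)) (proj₂ (complete b))

  _[_↦_] : PartialColouring → (u : Fin (n G)) → Fin (size C u) → PartialColouring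
  (φ [ u ↦ y ]) v with v ≟ u
  ... | yes refl = just y
  ... | no  _    = φ v

  ↦-here : ∀ φ u y → (φ [ u ↦ y ]) u ≡ just y
  ↦-here φ u y with u ≟ u
  ... | yes refl = refl
  ... | no  u≢u  = contradiction refl u≢u

  ↦-there : ∀ φ {u} y {v} → v ≢ u → (φ [ u ↦ y ]) v ≡ φ v
  ↦-there φ {u} y {v} v≢u with v ≟ u
  ... | yes v≡u = contradiction v≡u v≢u
  ... | no  _   = refl

  ↦-proper : ∀ {φ u y} → Proper φ → Free φ u y → Proper (φ [ u ↦ y ])
  ↦-proper {φ} {u} proper free a b φa φb with a ≟ u | b ≟ u
  ↦-proper proper free a b refl refl | yes refl | yes refl = H-irrefl C _
  ↦-proper proper free a b refl φb   | yes refl | no  _    = trans (H-sym C _ _) (free b φb)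
  ↦-proper proper free a b φa   refl | no  _    | yes refl = free a φa
  ↦-proper proper free a b φa   φb   | no  _    | no  _    = proper a b φa φb

  ↦-uncoloured : ∀ {φ u y S} → u ∉ S → (∀ v → v ∈ ⁅ u ⁆ ∪ S ⇔ φ v ≡ nothing) →
                 ∀ v → v ∈ S ⇔ (φ [ u ↦ y ]) v ≡ nothing
  ↦-uncoloured {φ} {u} {y} {S} u∉S S′⇔ v with v ≟ u
  ... | yes refl = mk⇔ (λ u∈S → contradiction u∈S u∉S) (λ ())
  ... | no  v≢u  = mk⇔ (λ v∈S → Equivalence.to (S′⇔ v) (x∈p∪q⁺ (inj₂ v∈S))) from
    where
    from : φ v ≡ nothing → v ∈ S
    from φv with x∈p∪q⁻ ⁅ u ⁆ S (Equivalence.from (S′⇔ v) φv)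
    ... | inj₁ v∈⁅u⁆ = contradiction (x∈⁅y⁆⇒x≡y u v∈⁅u⁆) v≢u
    ... | inj₂ v∈S   = v∈S

  ↦-complete : ∀ φ {u} y → (∀ v → φ v ≡ nothing → v ≡ u) → Complete (φ [ u ↦ y ])
  ↦-complete φ {u} y only-u v with v ≟ u | φ v in φv
  ... | yes refl | _       = y , refl
  ... | no  v≢u  | just c  = c , φv
  ... | no  v≢u  | nothing = contradiction (only-u v φv) v≢u

  clash : ∀ {w u} → Maybe (Fin (size C w)) → Fin (size C u) → Bool
  clash         nothing  y = false
  clash {w} {u} (just c) y = H C (w , c) (u , y)

  excluded : PartialColouring → (u w : Fin (n G)) → ℕ
  excluded φ u w = count (clash {w} {u} (φ w))

  Slack : PartialColouring → Fin (n G) → Set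
  Slack φ u = ∃ λ w → excluded φ u w < e G u w

  nbrsIn≡count : ∀ a u → nbrsIn G C a u ≡ count (λ y → H C a (u , y))
  nbrsIn≡count a u = sum-map-allFin (λ y → if H C a (u , y) then 1 else 0)

  nbrsIn≤e : ∀ {w u} → w ≢ u → (c : Fin (size C w)) → nbrsIn G C (w , c) u ≤ e G w u
  nbrsIn≤e {w} {u} w≢u c = begin
    nbrsIn G C (w , c) u               ≡⟨ nbrsIn≡count (w , c) u ⟩
    count (λ y → H C (w , c) (u , y))  ≤⟨ count≤-injection _ (label C w u w≢u c) (label-matchingˡ C w u w≢u c) ⟩
    e G w u                            ∎
    where open ≤-Reasoning

  excluded≤e : ∀ {φ u} → φ u ≡ nothing → ∀ w → excluded φ u w ≤ e G u w
  excluded≤e {φ} {u} φu w with φ w in φw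
  ... | nothing = ≤-trans (≤-reflexive (count-false (size C u))) z≤n
  ... | just c  = begin
    count (λ y → H C (w , c) (u , y))   ≡⟨ nbrsIn≡count (w , c) u ⟨
    nbrsIn G C (w , c) u                ≤⟨ nbrsIn≤e w≢u c ⟩
    e G w u                             ≡⟨ e-sym G w u ⟩
    e G u w                             ∎
    where
    open ≤-Reasoning
    w≢u : w ≢ u
    w≢u refl with trans (sym φw) φu
    ... | ()

  slack-uncoloured : ∀ {φ u w} → φ w ≡ nothing → 0 < e G u w → Slack φ u
  slack-uncoloured {φ} {u} {w} φw e>0 = w , subst (λ m → count (clash {w} {u} m) < e G u w) (sym φw)
    (subst (_< e G u w) (sym (count-false (size C u))) e>0)

  slack-coloured : ∀ {φ u w c} → φ w ≡ just c → nbrsIn G C (w , c) u < e G w u → Slack φ u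
  slack-coloured {φ} {u} {w} {c} φw few = w , subst (λ m → count (clash {w} {u} m) < e G u w) (sym φw)
    (subst₂ _<_ (nbrsIn≡count (w , c) u) (e-sym G w u) few)

  deg≡∑e : ∀ u → deg G u ≡ ∑[ w < n G ] e G u w
  deg≡∑e u = sum-map-allFin (e G u)

  free-colour : (∀ v → deg G v ≤ size C v) → ∀ {φ u} → φ u ≡ nothing → Slack φ u → ∃ (Free φ u)
  free-colour deg≤size {φ} {u} φu (w , slack) =
    let y , no-clash = ∑count<⇒avoid (λ w → clash (φ w)) clashes<size
    in  y , λ w′ φw′ → subst (λ m → clash m y ≡ false) φw′ (no-clash w′)
    where
    open ≤-Reasoning
    clashes<size : ∑[ w < n G ] excluded φ u w < size C u
    clashes<size = begin-strict
      ∑[ w < n G ] excluded φ u w <⟨ ∑-mono-< (excluded≤e {φ} φu) w slack ⟩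
      ∑[ w < n G ] e G u w        ≡⟨ deg≡∑e u ⟨
      deg G u                     ≤⟨ deg≤size u ⟩
      size C u                    ∎

  extend : (∀ v → deg G v ≤ size C v) → ∀ {r S} → Grown G r S →
           ∀ φ → Proper φ → (∀ v → v ∈ S ⇔ φ v ≡ nothing) →
           ∀ w₀ {c₀} → φ w₀ ≡ just c₀ → nbrsIn G C (w₀ , c₀) r < e G w₀ r → Colourable G C
  extend deg≤size {r} root φ proper S⇔ w₀ φw₀ few =
    let y , free = free-colour deg≤size {φ} φr (slack-coloured {φ} φw₀ few)
    in  complete⇒colourable (φ [ r ↦ y ]) (↦-proper proper free) (↦-complete φ y only-r)
    where
    φr : φ r ≡ nothing
    φr = Equivalence.to (S⇔ r) (x∈⁅x⁆ r)
    only-r : ∀ v → φ v ≡ nothing → v ≡ r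
    only-r v φv = x∈⁅y⁆⇒x≡y r (Equivalence.from (S⇔ v) φv)
  extend deg≤size (attach u w grown u∉S w∈S e>0) φ proper S⇔ w₀ φw₀ few =
    let y , free = free-colour deg≤size {φ} φu (slack-uncoloured {φ} φw e>0)
    in  extend deg≤size grown (φ [ u ↦ y ]) (↦-proper proper free) (↦-uncoloured u∉S S⇔)
               w₀ (trans (↦-there φ y w₀≢u) φw₀) few
    where
    φu : φ u ≡ nothing
    φu = Equivalence.to (S⇔ u) (x∈p∪q⁺ (inj₁ (x∈⁅x⁆ u)))
    φw : φ w ≡ nothing
    φw = Equivalence.to (S⇔ w) (x∈p∪q⁺ (inj₂ w∈S))
    w₀≢u : w₀ ≢ u
    w₀≢u refl with trans (sym φw₀) φu
    ... | ()

lemma5 : (G : Multigraph) (C : Cover G) → Connected G →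
    (∀ v → deg G v ≤ size C v) →
    (v₁ : Fin (n G)) (x₁ : Fin (size C v₁)) →
    ConnectedMinus G v₁ →
    Σ (Fin (n G)) (λ v₂ → v₂ ≢ v₁ × nbrsIn G C (v₁ , x₁) v₂ < e G v₁ v₂) →
    Colourable G C
lemma5 G C _ deg≤size v₁ x₁ G-v₁-connected (v₂ , v₂≢v₁ , few)
  with spanning-growth G (λ v → ¬? (v ≟ v₁)) v₂ v₂≢v₁ (λ v → G-v₁-connected v₂ v v₂≢v₁)
... | S , grown , S⇔≢v₁ =
  extend deg≤size grown φ₀ (↦-proper (λ _ _ ()) (λ _ ())) uncoloured₀ v₁ (↦-here _ v₁ x₁) few
  where
  open PartialColourings C
  φ₀ : PartialColouring
  φ₀ = (λ _ → nothing) [ v₁ ↦ x₁ ]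
  uncoloured₀ : ∀ v → v ∈ S ⇔ φ₀ v ≡ nothing
  uncoloured₀ v with v ≟ v₁
  ... | yes refl = mk⇔ (λ v₁∈S → contradiction refl (Equivalence.to (S⇔≢v₁ v₁) v₁∈S)) (λ ())
  ... | no  v≢v₁ = mk⇔ (λ _ → refl) (λ _ → Equivalence.from (S⇔≢v₁ v) v≢v₁)
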